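{- Let $\lambda$ be a partition with $d(\lambda)\ge3$, let $\ell=d(\lambda)-3$, and let $A=\mathcal{L}(\lambda)$. Then $\mathbb{SG}(A)=\mathbb{SG}(A[\ell,\ell])$.
   Context: For a partition $\mu=(\mu_1,\dots,\mu_s)$ and nonnegative integers $i,j$, $\mu[i,j]$ is $(\mu_{i+1}-j,\mu_{i+2}-j,\dots)$ with nonpositive entries removed, if $i<s$ and $j<\mu_{i+1}$; otherwise $\mu[i,j]=()$. The Durfee length is $d(\mu)=\max\{k:\mu_k\ge k\}$. LCTR $\mathcal{L}(\lambda)$: impartial normal-play game on partitions; from a nonempty $\mu$ one moves to $\mu[1,0]$ or $\mu[0,1]$; $()$ is terminal. For $A=\mathcal{L}(\lambda)$, $A[i,j]=\mathcal{L}(\lambda[i,j])$. $\mathbb{SG}$ is the Sprague--Grundy value, $\mathbb{SG}(A)=\operatorname{mex}\{\mathbb{SG}(B):A\to B\}$. -}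

module Defs where

open import Data.Nat using (ℕ; zero; suc; _+_; _∸_; _≤_; _<_; _<ᵇ_; _≤ᵇ_; _⊔_)
open import Data.Bool using (Bool; true; false; if_then_else_)
open import Data.List using (List; []; _∷_; drop; map; filter; length; foldr; upTo)
open import Data.Nat.ListAction using (sum)
open import Data.Bool.ListAction using (any)
open import Data.List.Relation.Unary.All using (All)
open import Data.List.Relation.Unary.Linked using (Linked)
open import Data.Nat using (_>?_)

IsPartition : List ℕ → Set
IsPartition μ = All (0 <_) μ × Linked _≥_ μ
  where
  open import Data.Product using (_×_)
  open import Data.Nat using (_≥_)

-- μ[i,j] exactly as in the paper: if i < s and j < μ_{i+1}, take
-- (μ_{i+1}-j, μ_{i+2}-j, …) with nonpositive entries removed; otherwise ().
cut : ℕ → ℕ → List ℕ → List ℕ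
cut i j μ with drop i μ
... | []     = []
... | x ∷ xs = if j <ᵇ x then filter (_>? 0) (map (_∸ j) (x ∷ xs)) else []

-- k-th part (1-indexed), 0 if out of range
part : List ℕ → ℕ → ℕ
part []       _             = 0
part (x ∷ xs) zero          = 0
part (x ∷ xs) (suc zero)    = x
part (x ∷ xs) (suc (suc k)) = part xs (suc k)

-- Durfee length d(μ) = max{k : μ_k ≥ k}  (max ∅ = 0); only k ≤ length μ can qualify
durfee : List ℕ → ℕ
durfee μ = foldr _⊔_ 0 (map (λ k → if suc k ≤ᵇ part μ (suc k) then suc k else 0) (upTo (length μ)))

mexFrom : ℕ → ℕ → List ℕ → ℕ
mexFrom zero    k xs = k
mexFrom (suc f) k xs = if any (λ x → x Data.Nat.≡ᵇ k) xs then mexFrom f (suc k) xs else k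

mex : List ℕ → ℕ
mex xs = mexFrom (suc (length xs)) 0 xs

-- options of the LCTR game L(μ): () is terminal, otherwise μ[1,0] and μ[0,1]
options : List ℕ → List (List ℕ)
options []      = []
options (x ∷ μ) = cut 1 0 (x ∷ μ) ∷ cut 0 1 (x ∷ μ) ∷ []

-- Sprague–Grundy value with fuel (every move strictly decreases the size of a
-- partition, so fuel = |μ| + 1 suffices)
sgFuel : ℕ → List ℕ → ℕ
sgFuel zero    μ = 0
sgFuel (suc f) μ = mex (map (sgFuel f) (options μ))

SG : List ℕ → ℕ
SG μ = sgFuel (suc (sum μ)) μ

module Submission where

-- Fix k with k + 4 ≤ d(λ) and put V a b = SG(λ[k+a, k+b]).  Whenever λ[k+a, k+b] ≠ (),
-- its two options are λ[k+a+1, k+b] and λ[k+a, k+b+1], so V a b = mex {V (a+1) b, V a (b+1)};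
-- this holds for all a, b ≤ 3, as these cells lie in the Durfee square.  Such a grid takes
-- values in {0,1,2}, and neighbours on its row 3 and column 3 differ; a finite check over
-- these boundaries gives V 0 0 = V 1 1.  Stepping down the diagonal from λ[0,0] = λ to
-- λ[ℓ,ℓ] proves the claim.

open import Defs
open import Data.Bool using (true; false; if_then_else_; T)
open import Data.List using (List; []; _∷_; drop; map; filter; length; upTo)
open import Data.List.Properties using (filter-accept; filter-reject; filter-none; map-cong; map-∘; foldr-preservesᵇ)
open import Data.List.Relation.Unary.All using (All; []; _∷_)
import Data.List.Relation.Unary.All as All
open import Data.List.Relation.Unary.All.Properties using (all-filter; map⁺)
open import Data.List.Relation.Unary.Linked using (Linked; [-]; _∷_)
import Data.List.Relation.Unary.Linked as Linked
open import Data.List.Relation.Unary.Linked.Properties using (Linked⇒All)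
open import Data.Nat
open import Data.Nat.ListAction using (sum)
open import Data.Nat.Properties
open import Data.Product using (_,_)
open import Data.Sum using (_⊎_; inj₁; inj₂)
open import Relation.Binary.PropositionalEquality
open import Relation.Nullary using (Dec; ¬?; does; contradiction)
open import Relation.Nullary.Decidable using (_→-dec_; toWitness)

mex₂ : ℕ → ℕ → ℕ
mex₂ a b = mex (a ∷ b ∷ [])

mex₂<3 : ∀ a b → mex₂ a b < 3
mex₂<3 zero          zero          = s≤s (s≤s z≤n)
mex₂<3 zero          (suc zero)    = ≤-refl
mex₂<3 zero          (suc (suc b)) = s≤s (s≤s z≤n)
mex₂<3 (suc zero)    zero          = ≤-refl
mex₂<3 (suc zero)    (suc zero)    = s≤s z≤n
mex₂<3 (suc zero)    (suc (suc b)) = s≤s z≤n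
mex₂<3 (suc (suc a)) zero          = s≤s (s≤s z≤n)
mex₂<3 (suc (suc a)) (suc zero)    = s≤s z≤n
mex₂<3 (suc (suc a)) (suc (suc b)) = s≤s z≤n

mex₂≢ˡ : ∀ a b → mex₂ a b ≢ a
mex₂≢ˡ zero          zero          ()
mex₂≢ˡ zero          (suc zero)    ()
mex₂≢ˡ zero          (suc (suc b)) ()
mex₂≢ˡ (suc zero)    zero          ()
mex₂≢ˡ (suc zero)    (suc zero)    ()
mex₂≢ˡ (suc zero)    (suc (suc b)) ()
mex₂≢ˡ (suc (suc a)) zero          ()
mex₂≢ˡ (suc (suc a)) (suc zero)    ()
mex₂≢ˡ (suc (suc a)) (suc (suc b)) ()

mex₂≢ʳ : ∀ a b → mex₂ a b ≢ b
mex₂≢ʳ zero          zero          ()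
mex₂≢ʳ zero          (suc zero)    ()
mex₂≢ʳ zero          (suc (suc b)) ()
mex₂≢ʳ (suc zero)    zero          ()
mex₂≢ʳ (suc zero)    (suc zero)    ()
mex₂≢ʳ (suc zero)    (suc (suc b)) ()
mex₂≢ʳ (suc (suc a)) zero          ()
mex₂≢ʳ (suc (suc a)) (suc zero)    ()
mex₂≢ʳ (suc (suc a)) (suc (suc b)) ()

-- The values V a b, a b ≤ 2, of a grid obeying V a b = mex₂ (V (1+a) b) (V a (1+b)),
-- computed from its row 3 (r₀ r₁ r₂ r₃) and column 3 (c₀ c₁ c₂ r₃).
module MexBlock (r₀ r₁ r₂ c₀ c₁ c₂ : ℕ) where
  v₂₂ v₂₁ v₁₂ v₁₁ v₂₀ v₀₂ v₁₀ v₀₁ v₀₀ : ℕ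
  v₂₂ = mex₂ r₂ c₂
  v₂₁ = mex₂ r₁ v₂₂
  v₁₂ = mex₂ v₂₂ c₁
  v₁₁ = mex₂ v₂₁ v₁₂
  v₂₀ = mex₂ r₀ v₂₁
  v₀₂ = mex₂ v₁₂ c₀
  v₁₀ = mex₂ v₂₀ v₁₁
  v₀₁ = mex₂ v₁₁ v₀₂
  v₀₀ = mex₂ v₁₀ v₀₁

open MexBlock

MexBlockDiagonal : ℕ → ℕ → ℕ → ℕ → ℕ → ℕ → ℕ → Set
MexBlockDiagonal r₀ r₁ r₂ r₃ c₀ c₁ c₂ =
  r₀ ≢ r₁ → r₁ ≢ r₂ → r₂ ≢ r₃ → c₀ ≢ c₁ → c₁ ≢ c₂ → c₂ ≢ r₃ →
  v₀₀ r₀ r₁ r₂ c₀ c₁ c₂ ≡ v₁₁ r₀ r₁ r₂ c₀ c₁ c₂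

mexBlockDiagonal? : ∀ r₀ r₁ r₂ r₃ c₀ c₁ c₂ → Dec (MexBlockDiagonal r₀ r₁ r₂ r₃ c₀ c₁ c₂)
mexBlockDiagonal? r₀ r₁ r₂ r₃ c₀ c₁ c₂ =
  ¬? (r₀ ≟ r₁) →-dec ¬? (r₁ ≟ r₂) →-dec ¬? (r₂ ≟ r₃) →-dec
  ¬? (c₀ ≟ c₁) →-dec ¬? (c₁ ≟ c₂) →-dec ¬? (c₂ ≟ r₃) →-dec
  v₀₀ r₀ r₁ r₂ c₀ c₁ c₂ ≟ v₁₁ r₀ r₁ r₂ c₀ c₁ c₂

mexBlock-diagonal :
  ∀ {r₀} → r₀ < 3 → ∀ {r₁} → r₁ < 3 → ∀ {r₂} → r₂ < 3 → ∀ {r₃} → r₃ < 3 →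
  ∀ {c₀} → c₀ < 3 → ∀ {c₁} → c₁ < 3 → ∀ {c₂} → c₂ < 3 →
  MexBlockDiagonal r₀ r₁ r₂ r₃ c₀ c₁ c₂
mexBlock-diagonal = toWitness {a? =
  allUpTo? (λ r₀ → allUpTo? (λ r₁ → allUpTo? (λ r₂ → allUpTo? (λ r₃ →
  allUpTo? (λ c₀ → allUpTo? (λ c₁ → allUpTo? (λ c₂ →
  mexBlockDiagonal? r₀ r₁ r₂ r₃ c₀ c₁ c₂) 3) 3) 3) 3) 3) 3) 3} _

MexGrid : (ℕ → ℕ → ℕ) → ℕ → Set
MexGrid V n = ∀ {a b} → a ≤ n → b ≤ n → V a b ≡ mex₂ (V (suc a) b) (V a (suc b))

mexGrid-<3 : ∀ {V n} → MexGrid V n → ∀ {a b} → a ≤ n → b ≤ n → V a b < 3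
mexGrid-<3 {V} grid {a} {b} a≤n b≤n rewrite grid a≤n b≤n = mex₂<3 (V (suc a) b) (V a (suc b))

mexGrid-row : ∀ {V n} → MexGrid V n → ∀ {b} → b ≤ n → V n b ≢ V n (suc b)
mexGrid-row {V} {n} grid {b} b≤n eq = mex₂≢ʳ (V (suc n) b) (V n (suc b)) (trans (sym (grid ≤-refl b≤n)) eq)

mexGrid-column : ∀ {V n} → MexGrid V n → ∀ {a} → a ≤ n → V a n ≢ V (suc a) n
mexGrid-column {V} {n} grid {a} a≤n eq = mex₂≢ˡ (V (suc a) n) (V a (suc n)) (trans (sym (grid a≤n ≤-refl)) eq)

mexGrid-diagonal : ∀ {V} → MexGrid V 3 → V 0 0 ≡ V 1 1
mexGrid-diagonal {V} grid = begin
  V 0 0                      ≡⟨ V₀₀ ⟩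
  v₀₀ r₀ r₁ r₂ c₀ c₁ c₂      ≡⟨ diagonal ⟩
  v₁₁ r₀ r₁ r₂ c₀ c₁ c₂      ≡⟨ V₁₁ ⟨
  V 1 1                      ∎
  where
  open ≡-Reasoning
  r₀ r₁ r₂ r₃ c₀ c₁ c₂ : ℕ
  r₀ = V 3 0 ; r₁ = V 3 1 ; r₂ = V 3 2 ; r₃ = V 3 3
  c₀ = V 0 3 ; c₁ = V 1 3 ; c₂ = V 2 3
  0≤3 : 0 ≤ 3
  0≤3 = z≤n
  1≤3 : 1 ≤ 3
  1≤3 = s≤s z≤n
  2≤3 : 2 ≤ 3
  2≤3 = s≤s (s≤s z≤n)
  3≤3 : 3 ≤ 3
  3≤3 = ≤-refl
  V₂₂ : V 2 2 ≡ v₂₂ r₀ r₁ r₂ c₀ c₁ c₂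
  V₂₂ = grid 2≤3 2≤3
  V₂₁ : V 2 1 ≡ v₂₁ r₀ r₁ r₂ c₀ c₁ c₂
  V₂₁ = trans (grid 2≤3 1≤3) (cong (mex₂ r₁) V₂₂)
  V₁₂ : V 1 2 ≡ v₁₂ r₀ r₁ r₂ c₀ c₁ c₂
  V₁₂ = trans (grid 1≤3 2≤3) (cong (λ v → mex₂ v c₁) V₂₂)
  V₁₁ : V 1 1 ≡ v₁₁ r₀ r₁ r₂ c₀ c₁ c₂
  V₁₁ = trans (grid 1≤3 1≤3) (cong₂ mex₂ V₂₁ V₁₂)
  V₀₀ : V 0 0 ≡ v₀₀ r₀ r₁ r₂ c₀ c₁ c₂
  V₀₀ = trans (grid 0≤3 0≤3) (cong₂ mex₂
          (trans (grid 1≤3 0≤3) (cong₂ mex₂ (trans (grid 2≤3 0≤3) (cong (mex₂ r₀) V₂₁)) V₁₁))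
          (trans (grid 0≤3 1≤3) (cong₂ mex₂ V₁₁ (trans (grid 0≤3 2≤3) (cong (λ v → mex₂ v c₀) V₁₂)))))
  bounded : ∀ {a b} → a ≤ 3 → b ≤ 3 → V a b < 3
  bounded = mexGrid-<3 grid
  diagonal : v₀₀ r₀ r₁ r₂ c₀ c₁ c₂ ≡ v₁₁ r₀ r₁ r₂ c₀ c₁ c₂
  diagonal = mexBlock-diagonal
    (bounded 3≤3 0≤3) (bounded 3≤3 1≤3) (bounded 3≤3 2≤3) (bounded 3≤3 3≤3)
    (bounded 0≤3 3≤3) (bounded 1≤3 3≤3) (bounded 2≤3 3≤3)
    (mexGrid-row grid 0≤3) (mexGrid-row grid 1≤3) (mexGrid-row grid 2≤3)
    (mexGrid-column grid 0≤3) (mexGrid-column grid 1≤3) (mexGrid-column grid 2≤3)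

Positive : List ℕ → Set
Positive = All (0 <_)

Sorted : List ℕ → Set
Sorted = Linked _≥_

-- μ[0,j] for j below the first part: subtract j from every part and drop the parts that vanish.
lower : ℕ → List ℕ → List ℕ
lower j μ = filter (_>? 0) (map (_∸ j) μ)

lower-positive : ∀ j μ → Positive (lower j μ)
lower-positive j μ = all-filter (_>? 0) (map (_∸ j) μ)

lower-0 : ∀ {μ} → Positive μ → lower 0 μ ≡ μ
lower-0 []          = refl
lower-0 (x>0 ∷ μ>0) = trans (filter-accept (_>? 0) x>0) (cong (_ ∷_) (lower-0 μ>0))

lower-∷ : ∀ {j x} μ → j < x → lower j (x ∷ μ) ≡ (x ∸ j) ∷ lower j μ
lower-∷ μ j<x = filter-accept (_>? 0) (m<n⇒0<n∸m j<x)

lower-≤ : ∀ {j μ} → All (_≤ j) μ → lower j μ ≡ []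
lower-≤ μ≤j = filter-none (_>? 0) (map⁺ (All.map (λ x≤j → ≤⇒≯ (≤-reflexive (m≤n⇒m∸n≡0 x≤j))) μ≤j))

lower-filter : ∀ k μ → lower k (filter (_>? 0) μ) ≡ lower k μ
lower-filter k []            = refl
lower-filter k (zero ∷ μ)    = trans (lower-filter k μ)
  (sym (filter-reject (_>? 0) (≤⇒≯ (≤-reflexive (0∸n≡0 k)))))
lower-filter k (suc x ∷ μ) with does (suc x ∸ k >? 0)
... | true  = cong (suc x ∸ k ∷_) (lower-filter k μ)
... | false = lower-filter k μ

lower-lower : ∀ k j μ → lower k (lower j μ) ≡ lower (k + j) μ
lower-lower k j μ = begin
  lower k (lower j μ)                             ≡⟨ lower-filter k (map (_∸ j) μ) ⟩
  filter (_>? 0) (map (_∸ k) (map (_∸ j) μ))      ≡⟨ cong (filter (_>? 0)) (map-∘ μ) ⟨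
  filter (_>? 0) (map (λ x → x ∸ j ∸ k) μ)        ≡⟨ cong (filter (_>? 0)) (map-cong ∸-twice μ) ⟩
  lower (k + j) μ                                 ∎
  where
  open ≡-Reasoning
  ∸-twice : ∀ x → x ∸ j ∸ k ≡ x ∸ (k + j)
  ∸-twice x = trans (∸-+-assoc x j k) (cong (x ∸_) (+-comm j k))

sum-lower : ∀ j μ → sum (lower j μ) ≤ sum μ
sum-lower j []      = z≤n
sum-lower j (x ∷ μ) with does (x ∸ j >? 0)
... | true  = +-mono-≤ (m∸n≤m x j) (sum-lower j μ)
... | false = ≤-trans (sum-lower j μ) (m≤n+m (sum μ) x)

cut-suc-∷ : ∀ i j x μ → cut (suc i) j (x ∷ μ) ≡ cut i j μ
cut-suc-∷ i j x μ with drop i μ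
... | []     = refl
... | y ∷ ys = refl

cut-0-lower-∷ : ∀ {j x} μ → j < x → cut 0 j (x ∷ μ) ≡ (x ∸ j) ∷ lower j μ
cut-0-lower-∷ {j} {x} μ j<x with j <ᵇ x | <⇒<ᵇ j<x
... | true | _ = lower-∷ μ j<x

cut-0-≢[] : ∀ {j x} μ → j < x → cut 0 j (x ∷ μ) ≢ []
cut-0-≢[] μ j<x eq with trans (sym (cut-0-lower-∷ μ j<x)) eq
... | ()

cut-0-0 : ∀ {μ} → Positive μ → cut 0 0 μ ≡ μ
cut-0-0 {[]}        _   = refl
cut-0-0 {suc x ∷ μ} μ>0 = lower-0 μ>0
cut-0-0 {zero ∷ μ}  (() ∷ _)

cut-0-sorted : ∀ {j μ} → Sorted μ → cut 0 j μ ≡ lower j μ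
cut-0-sorted {j} {[]}    _      = refl
cut-0-sorted {j} {x ∷ μ} sorted with j <ᵇ x in j<ᵇx
... | true  = refl
... | false = sym (lower-≤ (Linked⇒All (λ j≥x x≥y → ≤-trans x≥y j≥x) x≤j sorted))
  where
  x≤j : x ≤ j
  x≤j = ≮⇒≥ (λ j<x → subst T j<ᵇx (<⇒<ᵇ j<x))

cut-positive : ∀ i j μ → Positive (cut i j μ)
cut-positive zero    j []      = []
cut-positive zero    j (x ∷ μ) with j <ᵇ x
... | true  = lower-positive j (x ∷ μ)
... | false = []
cut-positive (suc i) j []      = []
cut-positive (suc i) j (x ∷ μ) = subst Positive (sym (cut-suc-∷ i j x μ)) (cut-positive i j μ)

1<ᵇn∸m≡1+m<ᵇn : ∀ m n → (1 <ᵇ n ∸ m) ≡ (suc m <ᵇ n)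
1<ᵇn∸m≡1+m<ᵇn zero    n       = refl
1<ᵇn∸m≡1+m<ᵇn (suc m) zero    = refl
1<ᵇn∸m≡1+m<ᵇn (suc m) (suc n) = 1<ᵇn∸m≡1+m<ᵇn m n

cut-1-0-cut-0 : ∀ {j x μ} → Sorted (x ∷ μ) → j < x → cut 1 0 (cut 0 j (x ∷ μ)) ≡ cut 0 j μ
cut-1-0-cut-0 {j} {x} {μ} sorted j<x = begin
  cut 1 0 (cut 0 j (x ∷ μ))        ≡⟨ cong (cut 1 0) (cut-0-lower-∷ μ j<x) ⟩
  cut 1 0 ((x ∸ j) ∷ lower j μ)    ≡⟨ cut-suc-∷ 0 0 (x ∸ j) (lower j μ) ⟩
  cut 0 0 (lower j μ)              ≡⟨ cut-0-0 (lower-positive j μ) ⟩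
  lower j μ                        ≡⟨ cut-0-sorted (Linked.tail sorted) ⟨
  cut 0 j μ                        ∎
  where open ≡-Reasoning

cut-0-1-cut-0 : ∀ {j x} μ → j < x → cut 0 1 (cut 0 j (x ∷ μ)) ≡ cut 0 (suc j) (x ∷ μ)
cut-0-1-cut-0 {j} {x} μ j<x = begin
  cut 0 1 (cut 0 j (x ∷ μ))        ≡⟨ cong (cut 0 1) (cut-0-lower-∷ μ j<x) ⟩
  cut 0 1 ((x ∸ j) ∷ lower j μ)    ≡⟨ cong₂ (λ b ν → if b then ν else []) (1<ᵇn∸m≡1+m<ᵇn j x) lowered ⟩
  cut 0 (suc j) (x ∷ μ)            ∎
  where
  open ≡-Reasoning
  lowered : lower 1 ((x ∸ j) ∷ lower j μ) ≡ lower (suc j) (x ∷ μ)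
  lowered = trans (cong (lower 1) (sym (lower-∷ μ j<x))) (lower-lower 1 j (x ∷ μ))

sum-cut-0 : ∀ j μ → sum (cut 0 j μ) ≤ sum μ
sum-cut-0 j []      = z≤n
sum-cut-0 j (x ∷ μ) with j <ᵇ x
... | true  = sum-lower j (x ∷ μ)
... | false = z≤n

sum-cut-1-0 : ∀ {x} μ → 0 < x → sum (cut 1 0 (x ∷ μ)) < sum (x ∷ μ)
sum-cut-1-0 {x} μ x>0 = begin-strict
  sum (cut 1 0 (x ∷ μ))  ≡⟨ cong sum (cut-suc-∷ 0 0 x μ) ⟩
  sum (cut 0 0 μ)        ≤⟨ sum-cut-0 0 μ ⟩
  sum μ                  <⟨ m<n+m (sum μ) x>0 ⟩
  x + sum μ              ∎
  where open ≤-Reasoning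

sum-cut-0-1 : ∀ {x} μ → 0 < x → sum (cut 0 1 (x ∷ μ)) < sum (x ∷ μ)
sum-cut-0-1 {suc zero}    μ _ = s≤s z≤n
sum-cut-0-1 {suc (suc x)} μ _ = s≤s (+-monoʳ-≤ (suc x) (sum-lower 1 μ))

-- Every move decreases the size, so any fuel beyond the size gives the same value.
sgFuel-stable : ∀ {f g μ} → Positive μ → sum μ < f → sum μ < g → sgFuel f μ ≡ sgFuel g μ
sgFuel-stable {suc f} {suc g} {[]}    _         _         _         = refl
sgFuel-stable {suc f} {suc g} {x ∷ μ} (x>0 ∷ _) (s≤s μ≤f) (s≤s μ≤g) =
  cong₂ mex₂ (stable {1} {0} (sum-cut-1-0 μ x>0)) (stable {0} {1} (sum-cut-0-1 μ x>0))
  where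
  stable : ∀ {i j} → sum (cut i j (x ∷ μ)) < sum (x ∷ μ) →
           sgFuel f (cut i j (x ∷ μ)) ≡ sgFuel g (cut i j (x ∷ μ))
  stable {i} {j} smaller =
    sgFuel-stable (cut-positive i j (x ∷ μ)) (<-≤-trans smaller μ≤f) (<-≤-trans smaller μ≤g)

SG-step : ∀ {μ} → Positive μ → μ ≢ [] → SG μ ≡ mex₂ (SG (cut 1 0 μ)) (SG (cut 0 1 μ))
SG-step {[]}    _         []≢[] = contradiction refl []≢[]
SG-step {x ∷ μ} (x>0 ∷ _) _ = cong₂ mex₂
  (sgFuel-stable (cut-positive 1 0 (x ∷ μ)) (sum-cut-1-0 μ x>0) ≤-refl)
  (sgFuel-stable (cut-positive 0 1 (x ∷ μ)) (sum-cut-0-1 μ x>0) ≤-refl)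

SG-cut-0-step : ∀ {j x μ} → Sorted (x ∷ μ) → j < x →
  SG (cut 0 j (x ∷ μ)) ≡ mex₂ (SG (cut 0 j μ)) (SG (cut 0 (suc j) (x ∷ μ)))
SG-cut-0-step {j} {x} {μ} sorted j<x = begin
  SG (cut 0 j (x ∷ μ))
    ≡⟨ SG-step (cut-positive 0 j (x ∷ μ)) (cut-0-≢[] μ j<x) ⟩
  mex₂ (SG (cut 1 0 (cut 0 j (x ∷ μ)))) (SG (cut 0 1 (cut 0 j (x ∷ μ))))
    ≡⟨ cong₂ (λ ν ν′ → mex₂ (SG ν) (SG ν′)) (cut-1-0-cut-0 sorted j<x) (cut-0-1-cut-0 μ j<x) ⟩
  mex₂ (SG (cut 0 j μ)) (SG (cut 0 (suc j) (x ∷ μ)))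
    ∎
  where open ≡-Reasoning

SG-cut-step : ∀ {μ} i {j} → Sorted μ → j < part μ (suc i) →
  SG (cut i j μ) ≡ mex₂ (SG (cut (suc i) j μ)) (SG (cut i (suc j) μ))
SG-cut-step {[]}    i       _      ()
SG-cut-step {x ∷ μ} zero    {j} sorted j<x
  rewrite cut-suc-∷ 0 j x μ = SG-cut-0-step sorted j<x
SG-cut-step {x ∷ μ} (suc i) {j} sorted j<part
  rewrite cut-suc-∷ i j x μ | cut-suc-∷ (suc i) j x μ | cut-suc-∷ i (suc j) x μ
  = SG-cut-step i (Linked.tail sorted) j<part

durfee-zero-or-square : ∀ μ → durfee μ ≡ 0 ⊎ durfee μ ≤ part μ (durfee μ)
durfee-zero-or-square μ =
  foldr-preservesᵇ {P = InSquare} ⊔-InSquare (inj₁ refl) (map⁺ (All.universal candidate (upTo (length μ))))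
  where
  InSquare : ℕ → Set
  InSquare k = k ≡ 0 ⊎ k ≤ part μ k
  ⊔-InSquare : ∀ {k l} → InSquare k → InSquare l → InSquare (k ⊔ l)
  ⊔-InSquare {k} {l} k∈ l∈ with ⊔-sel k l
  ... | inj₁ k⊔l≡k rewrite k⊔l≡k = k∈
  ... | inj₂ k⊔l≡l rewrite k⊔l≡l = l∈
  candidate : ∀ k → InSquare (if suc k ≤ᵇ part μ (suc k) then suc k else 0)
  candidate k with suc k ≤ᵇ part μ (suc k) in k<part
  ... | true  = inj₂ (≤ᵇ⇒≤ (suc k) _ (subst T (sym k<part) _))
  ... | false = inj₁ refl

durfee-square : ∀ μ → 0 < durfee μ → durfee μ ≤ part μ (durfee μ)
durfee-square μ d>0 with durfee-zero-or-square μ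
... | inj₁ d≡0 = contradiction d≡0 (>⇒≢ d>0)
... | inj₂ d≤d = d≤d

part-1≤head : ∀ {x μ} → Sorted (x ∷ μ) → part μ 1 ≤ x
part-1≤head [-]       = z≤n
part-1≤head (x≥y ∷ _) = x≥y

part-antitone : ∀ {μ i i′} → Sorted μ → i ≤ i′ → part μ (suc i′) ≤ part μ (suc i)
part-antitone {[]}                       _      _          = z≤n
part-antitone {x ∷ μ} {zero}  {zero}   _      _          = ≤-refl
part-antitone {x ∷ μ} {zero}  {suc i′} sorted _          =
  ≤-trans (part-antitone (Linked.tail sorted) z≤n) (part-1≤head sorted)
part-antitone {x ∷ μ} {suc i} {suc i′} sorted (s≤s i≤i′) = part-antitone (Linked.tail sorted) i≤i′

inside-square : ∀ {μ d i j} → Sorted μ → d ≤ part μ d → i < d → j < d → j < part μ (suc i)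
inside-square {d = suc d} sorted square (s≤s i≤d) j<d =
  <-≤-trans j<d (≤-trans square (part-antitone sorted i≤d))

SG-diagonal-step : ∀ {μ d k} → Sorted μ → d ≤ part μ d → 4 + k ≤ d →
  SG (cut k k μ) ≡ SG (cut (suc k) (suc k) μ)
SG-diagonal-step {μ} {d} {k} sorted square 4+k≤d = mexGrid-diagonal grid
  where
  within : ∀ {a} → a ≤ 3 → a + k < d
  within a≤3 = ≤-trans (s≤s (+-monoˡ-≤ k a≤3)) 4+k≤d
  grid : MexGrid (λ a b → SG (cut (a + k) (b + k) μ)) 3
  grid {a} a≤3 b≤3 = SG-cut-step (a + k) sorted (inside-square sorted square (within a≤3) (within b≤3))

SG-diagonal : ∀ {μ d} → Sorted μ → d ≤ part μ d → ∀ n → 3 + n ≤ d →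
  SG (cut 0 0 μ) ≡ SG (cut n n μ)
SG-diagonal sorted square zero    _       = refl
SG-diagonal sorted square (suc n) 4+n≤d =
  trans (SG-diagonal sorted square n (≤-trans (n≤1+n _) 4+n≤d)) (SG-diagonal-step sorted square 4+n≤d)

corollary5p5 : (λ′ : List ℕ) → IsPartition λ′ → 3 ≤ durfee λ′ →
    SG λ′ ≡ SG (cut (durfee λ′ ∸ 3) (durfee λ′ ∸ 3) λ′)
corollary5p5 μ (positive , sorted) 3≤d = begin
  SG μ                                    ≡⟨ cong SG (cut-0-0 positive) ⟨
  SG (cut 0 0 μ)                          ≡⟨ SG-diagonal sorted square (durfee μ ∸ 3) (≤-reflexive (m+[n∸m]≡n 3≤d)) ⟩
  SG (cut (durfee μ ∸ 3) (durfee μ ∸ 3) μ) ∎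
  where
  open ≡-Reasoning
  square : durfee μ ≤ part μ (durfee μ)
  square = durfee-square μ (≤-trans (s≤s z≤n) 3≤d)
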